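{- Let $G$ be a Latin square graph of even order. Then both $G$ and its complement are 1-factorable.
   Context: Given $t\ge 0$ mutually orthogonal Latin squares of order $m\ge 2$, the Latin square graph has as vertices the $m^2$ cells (entries), two distinct cells being adjacent if they lie in the same row, in the same column, or carry the same symbol in one of the $t$ squares. A graph is 1-factorable if its edge set can be partitioned into perfect matchings (1-factors). -}

module Defs where

open import Data.Nat using (ℕ; _≥_; _+_)
open import Data.Fin using (Fin)
open import Data.Product using (_×_; Σ; ∃; ∃-syntax; _,_)
open import Data.Sum using (_⊎_)
open import Relation.Binary.PropositionalEquality using (_≡_; _≢_)
open import Relation.Nullary using (¬_)
open import Level using (0ℓ) renaming (suc to lsuc)

record Graph : Set₁ where
  field
    V   : Set
    Adj : V → V → Set
open Graph public

complement : Graph → Graph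
complement G = record { V = V G ; Adj = λ u v → (u ≢ v) × ¬ Adj G u v }

record IsPerfectMatching (G : Graph) (M : V G → V G → Set) : Set where
  field
    edges    : ∀ {u v} → M u v → Adj G u v
    symm     : ∀ {u v} → M u v → M v u
    covers   : ∀ u → ∃[ v ] M u v
    unique   : ∀ {u v w} → M u v → M u w → v ≡ w

OneFactorable : Graph → Set₁
OneFactorable G =
  Σ ℕ λ c → Σ (Fin c → V G → V G → Set) λ F →
    (∀ k → IsPerfectMatching G (F k)) ×
    (∀ u v → Adj G u v → ∃[ k ] F k u v) ×
    (∀ {u v k l} → F k u v → F l u v → k ≡ l)

record LatinSquare (m : ℕ) : Set where
  field
    entry  : Fin m → Fin m → Fin m
    rowInj : ∀ i {j j′} → entry i j ≡ entry i j′ → j ≡ j′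
    colInj : ∀ j {i i′} → entry i j ≡ entry i′ j → i ≡ i′
open LatinSquare public

Orthogonal : ∀ {m} → LatinSquare m → LatinSquare m → Set
Orthogonal {m} A B = ∀ {i j i′ j′} →
  entry A i j ≡ entry A i′ j′ → entry B i j ≡ entry B i′ j′ → (i ≡ i′) × (j ≡ j′)

MOLS : ℕ → ℕ → Set
MOLS t m = Σ (Fin t → LatinSquare m) λ L → ∀ k l → k ≢ l → Orthogonal (L k) (L l)

Cell : ℕ → Set
Cell m = Fin m × Fin m

LatinSquareGraph : ∀ {t m} → MOLS t m → Graph
LatinSquareGraph {t} {m} (L , _) = record
  { V = Cell m
  ; Adj = λ { (i , j) (i′ , j′) →
      ((i , j) ≢ (i′ , j′)) ×
      ((i ≡ i′) ⊎ (j ≡ j′) ⊎ ∃[ k ] entry (L k) i j ≡ entry (L k) i′ j′) } }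

Even : ℕ → Set
Even m = ∃[ n ] m ≡ n + n

-- For even m the complete graph K_m has a 1-factorisation (the round-robin one on
-- ℤ_(m-1) ∪ {∞}).  The Latin square graph is the collinearity graph of the net whose
-- t + 2 parallel classes are the rows, the columns and the symbol classes of the
-- squares.  A line of the row class meets every column in exactly one cell, and a
-- line of any other class meets every row in exactly one cell, so a 1-factor of K_m
-- on the columns (resp. rows) lifts along each class to a 1-factor of the graph;
-- two distinct cells lie on at most one common line, so these factors partition the
-- edges.  Two cells in rows a ≠ b are non-adjacent unless they share a column or a
-- symbol, and for a fixed cell of row a this excludes exactly t + 1 cells of row b.
-- Hence between rows a and b the non-adjacent pairs form an (m − t − 1)-regular
-- bipartite graph, which by Hall's theorem splits into m − t − 1 perfect matchings
-- (König).  Pairing the rows by a 1-factor of K_m and then every matched pair of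
-- rows by its r-th perfect matching gives the 1-factors of the complement.
module Submission where

open import Defs
open import Data.Nat
  using (ℕ; zero; suc; _+_; _*_; _∸_; _≤_; _<_; _≥_; z≤n; s≤s; s≤s⁻¹; _≤?_; _<?_; ⌊_/2⌋)
import Data.Nat as ℕ
open import Data.Nat.Properties
  using ( +-0-commutativeMonoid; +-*-semiring; +-suc; +-comm; +-assoc; +-identityʳ
        ; +-cancelˡ-≡; +-cancelʳ-≡; +-cancelˡ-<; +-cancelʳ-<; +-cancelʳ-≤; *-cancelʳ-≤
        ; +-mono-≤; +-monoʳ-≤; +-mono-<; +-monoˡ-<; suc-injective
        ; ≤-refl; ≤-reflexive; ≤-trans; ≤-antisym; ≤-<-trans; <-irrefl; <⇒≤; <⇒≱; ≰⇒>; ≮⇒≥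
        ; m≤m+n; m≤n+m; n<1+n; m<n⇒m<1+n; m∸n≤m; m+n∸n≡m; m+[n∸m]≡n; m∸n+n≡m
        ; n≡⌊n+n/2⌋; even≢odd; module ≤-Reasoning )
open import Data.Nat.Solver using (module +-*-Solver)
open import Data.Bool using (true)
open import Data.Fin as Fin using (Fin; zero; suc; toℕ; fromℕ<; punchOut)
open import Data.Fin.Patterns using (0F; 1F)
open import Data.Fin.Properties as Finₚ
  using (_≟_; any?; toℕ<n; toℕ-injective; toℕ-fromℕ<; injective⇒≤; punchOut-injective; *↔×)
open import Data.Fin.Subset
open import Data.Fin.Subset.Properties
open import Data.Vec using ([]; _∷_; here; there; tabulate)
open import Data.Vec.Properties using ([]=⇒lookup; lookup⇒[]=; lookup∘tabulate)
open import Data.Product using (Σ; ∃; _×_; _,_; proj₁; proj₂)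
open import Data.Sum using (_⊎_; inj₁; inj₂)
open import Function using (_∘_; case_of_; _↔_; Inverse)
open import Function.Definitions using (Injective)
open import Level using (0ℓ)
open import Relation.Nullary using (Dec; yes; no; does; ¬_; ¬?; contradiction)
open import Relation.Nullary.Decidable using (_×-dec_; _⊎-dec_)
open import Relation.Unary using (Pred; Decidable)
open import Relation.Binary.Definitions using (tri<; tri≈; tri>) renaming (Decidable to Decidable₂)
open import Relation.Binary.PropositionalEquality
open import Algebra.Properties.CommutativeMonoid.Sum +-0-commutativeMonoid
  using (sum; sum-cong-≗; sum-replicate-zero; ∑-distrib-+; ∑-comm)
open import Algebra.Properties.Semiring.Sum +-*-semiring using (*-distribʳ-sum)

private variable
  n : ℕ
  x y : Fin n
  p q r : Subset n

-- Counting

𝟙 : ∀ {A : Set} → Dec A → ℕ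
𝟙 (yes _) = 1
𝟙 (no _)  = 0

𝟙-yes : ∀ {A : Set} → A → (a : Dec A) → 𝟙 a ≡ 1
𝟙-yes _ (yes _) = refl
𝟙-yes x (no ¬x) = contradiction x ¬x

𝟙-no : ∀ {A : Set} → ¬ A → (a : Dec A) → 𝟙 a ≡ 0
𝟙-no ¬x (yes x) = contradiction x ¬x
𝟙-no _  (no _)  = refl

𝟙-cong : ∀ {A B : Set} → (A → B) → (B → A) → (a : Dec A) (b : Dec B) → 𝟙 a ≡ 𝟙 b
𝟙-cong f g (yes _) (yes _) = refl
𝟙-cong f g (no _)  (no _)  = refl
𝟙-cong f g (yes a) (no ¬b) = contradiction (f a) ¬b
𝟙-cong f g (no ¬a) (yes b) = contradiction (g b) ¬a

𝟙-mono : ∀ {A B : Set} → (A → B) → (a : Dec A) (b : Dec B) → 𝟙 a ≤ 𝟙 b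
𝟙-mono f (yes a) (yes _) = s≤s z≤n
𝟙-mono f (yes a) (no ¬b) = contradiction (f a) ¬b
𝟙-mono f (no _)  _       = z≤n

𝟙-¬?+𝟙 : ∀ {A : Set} (a : Dec A) → 𝟙 (¬? a) + 𝟙 a ≡ 1
𝟙-¬?+𝟙 (yes _) = refl
𝟙-¬?+𝟙 (no _)  = refl

sum-ones : ∀ n → sum {n} (λ _ → 1) ≡ n
sum-ones zero    = refl
sum-ones (suc n) = cong suc (sum-ones n)

sum-mono-≤ : {f g : Fin n → ℕ} → (∀ i → f i ≤ g i) → sum f ≤ sum g
sum-mono-≤ {n = zero}  _   = z≤n
sum-mono-≤ {n = suc n} f≤g = +-mono-≤ (f≤g zero) (sum-mono-≤ (f≤g ∘ suc))

count : {P : Pred (Fin n) 0ℓ} → Decidable P → ℕ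
count P? = sum (𝟙 ∘ P?)

count-cong : {P Q : Pred (Fin n) 0ℓ} (P? : Decidable P) (Q? : Decidable Q) →
             (∀ {i} → P i → Q i) → (∀ {i} → Q i → P i) → count P? ≡ count Q?
count-cong P? Q? f g = sum-cong-≗ (λ i → 𝟙-cong f g (P? i) (Q? i))

count-mono : {P Q : Pred (Fin n) 0ℓ} (P? : Decidable P) (Q? : Decidable Q) →
             (∀ {i} → P i → Q i) → count P? ≤ count Q?
count-mono P? Q? f = sum-mono-≤ (λ i → 𝟙-mono f (P? i) (Q? i))

count-none : {P : Pred (Fin n) 0ℓ} (P? : Decidable P) → (∀ i → ¬ P i) → count P? ≡ 0
count-none {n = n} P? ¬P = trans (sum-cong-≗ (λ i → 𝟙-no (¬P i) (P? i))) (sum-replicate-zero n)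

count-×-dec : ∀ {A : Set} {P : Pred (Fin n) 0ℓ} (a : Dec A) (P? : Decidable P) →
              count (λ i → a ×-dec P? i) ≡ 𝟙 a * count P?
count-×-dec (yes a) P? = trans (count-cong (λ i → yes a ×-dec P? i) P? proj₂ (a ,_)) (sym (+-identityʳ _))
count-×-dec (no ¬a) P? = count-none (λ i → no ¬a ×-dec P? i) (λ _ → ¬a ∘ proj₁)

count-¬?+count : {P : Pred (Fin n) 0ℓ} (P? : Decidable P) → count (¬? ∘ P?) + count P? ≡ n
count-¬?+count {n = n} P? = begin
  count (¬? ∘ P?) + count P?           ≡⟨ ∑-distrib-+ (𝟙 ∘ ¬? ∘ P?) (𝟙 ∘ P?) ⟨
  sum (λ i → 𝟙 (¬? (P? i)) + 𝟙 (P? i)) ≡⟨ sum-cong-≗ (𝟙-¬?+𝟙 ∘ P?) ⟩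
  sum {n} (λ _ → 1)                    ≡⟨ sum-ones n ⟩
  n                                    ∎
  where open ≡-Reasoning

count-¬? : {P : Pred (Fin n) 0ℓ} (P? : Decidable P) → count (¬? ∘ P?) ≡ n ∸ count P?
count-¬? P? = trans (sym (m+n∸n≡m _ (count P?))) (cong (_∸ count P?) (count-¬?+count P?))

count-remove : {P : Pred (Fin n) 0ℓ} (P? : Decidable P) {x : Fin n} → P x →
               count P? ≡ suc (count (λ i → P? i ×-dec ¬? (i ≟ x)))
count-remove {n = suc n} {P} P? {zero} Px = begin
  𝟙 (P? zero) + count (P? ∘ suc)
    ≡⟨ cong₂ _+_ (𝟙-yes Px (P? zero)) (count-cong (P? ∘ suc) P′? (_, λ ()) proj₁) ⟩
  suc (count P′?)
    ≡⟨ cong (λ k → suc (k + count P′?))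
            (𝟙-no (λ (_ , 0≢0) → 0≢0 refl) (P? zero ×-dec ¬? (zero ≟ zero))) ⟨
  suc (count (λ i → P? i ×-dec ¬? (i ≟ zero))) ∎
  where
  open ≡-Reasoning
  P′? : Decidable (λ i → P (suc i) × suc i ≢ zero)
  P′? i = P? (suc i) ×-dec ¬? (suc i ≟ zero)
count-remove {n = suc n} P? {suc x} Px = begin
  𝟙 (P? zero) + count (P? ∘ suc)
    ≡⟨ cong (𝟙 (P? zero) +_) (count-remove (P? ∘ suc) Px) ⟩
  𝟙 (P? zero) + suc (count (λ i → P? (suc i) ×-dec ¬? (i ≟ x)))
    ≡⟨ +-suc _ _ ⟩
  suc (𝟙 (P? zero) + count (λ i → P? (suc i) ×-dec ¬? (i ≟ x)))
    ≡⟨ cong suc (cong₂ _+_ (𝟙-cong (_, λ ()) proj₁ (P? zero) (P? zero ×-dec ¬? (zero ≟ suc x)))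
                           (count-cong (λ i → P? (suc i) ×-dec ¬? (i ≟ x))
                                       (λ i → P? (suc i) ×-dec ¬? (suc i ≟ suc x))
                                       (λ (p , i≢x) → p , i≢x ∘ Finₚ.suc-injective)
                                       (λ (p , i≢x) → p , i≢x ∘ cong suc))) ⟩
  suc (count (λ i → P? i ×-dec ¬? (i ≟ suc x))) ∎
  where open ≡-Reasoning

count-image : ∀ {p} (h : Fin p → Fin n) → Injective _≡_ _≡_ h →
              count (λ y → any? (λ z → h z ≟ y)) ≡ p
count-image {p = zero} h _ = count-none (λ y → any? (λ z → h z ≟ y)) (λ _ ())
count-image {p = suc p} h h-inj = begin
  count (λ y → any? (λ z → h z ≟ y))
    ≡⟨ count-remove (λ y → any? (λ z → h z ≟ y)) (zero , refl) ⟩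
  suc (count (λ y → any? (λ z → h z ≟ y) ×-dec ¬? (y ≟ h zero)))
    ≡⟨ cong suc (count-cong (λ y → any? (λ z → h z ≟ y) ×-dec ¬? (y ≟ h zero))
                            (λ y → any? (λ z → h (suc z) ≟ y)) to from) ⟩
  suc (count (λ y → any? (λ z → h (suc z) ≟ y)))
    ≡⟨ cong suc (count-image (h ∘ suc) (Finₚ.suc-injective ∘ h-inj)) ⟩
  suc p ∎
  where
  open ≡-Reasoning
  to : ∀ {y} → (∃ λ z → h z ≡ y) × y ≢ h zero → ∃ λ z → h (suc z) ≡ y
  to ((zero  , refl) , y≢h0) = contradiction refl y≢h0
  to ((suc z , hz≡y) , _)    = z , hz≡y
  from : ∀ {y} → (∃ λ z → h (suc z) ≡ y) → (∃ λ z → h z ≡ y) × y ≢ h zero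
  from (z , refl) = (suc z , refl) , λ hz≡h0 → case h-inj hz≡h0 of λ ()

∣p∣≡count-∈ : (S : Subset n) → ∣ S ∣ ≡ count (_∈? S)
∣p∣≡count-∈ []            = refl
∣p∣≡count-∈ (inside ∷ S)  =
  cong suc (trans (∣p∣≡count-∈ S) (count-cong (_∈? S) (λ i → suc i ∈? inside ∷ S) there drop-there))
∣p∣≡count-∈ (outside ∷ S) =
  trans (∣p∣≡count-∈ S) (count-cong (_∈? S) (λ i → suc i ∈? outside ∷ S) there drop-there)

injective⇒surjective : {f : Fin n → Fin n} → Injective _≡_ _≡_ f → ∀ j → ∃ λ i → f i ≡ j
injective⇒surjective {zero}  _       ()
injective⇒surjective {suc n} {f} f-inj j with any? (λ i → f i ≟ j)
... | yes hit = hit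
... | no  miss = contradiction (injective⇒≤ g-inj) (<-irrefl refl)
  where
  g : Fin (suc n) → Fin n
  g i = punchOut {i = j} (λ j≡fi → miss (i , sym j≡fi))
  g-inj : Injective _≡_ _≡_ g
  g-inj {x} {y} = f-inj ∘ punchOut-injective (λ e → miss (x , sym e)) (λ e → miss (y , sym e))

-- Hall's theorem

x∈p─q⇒x∉q : x ∈ p ─ q → x ∉ q
x∈p─q⇒x∉q {p = _ ∷ p} {outside ∷ q} here         ()
x∈p─q⇒x∉q {p = _ ∷ p} {outside ∷ q} (there x∈p─q) (there x∈q) = x∈p─q⇒x∉q x∈p─q x∈q
x∈p─q⇒x∉q {p = _ ∷ p} {inside ∷ q}  (there x∈p─q) (there x∈q) = x∈p─q⇒x∉q x∈p─q x∈q

x∈p⇒⁅x⁆⊆p : x ∈ p → ⁅ x ⁆ ⊆ p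
x∈p⇒⁅x⁆⊆p {x = x} x∈p y∈⁅x⁆ rewrite x∈⁅y⁆⇒x≡y x y∈⁅x⁆ = x∈p

p⊆q∪[p─q] : ∀ q → p ⊆ q ∪ (p ─ q)
p⊆q∪[p─q] q {x} x∈p with x ∈? q
... | yes x∈q = x∈p∪q⁺ (inj₁ x∈q)
... | no  x∉q = x∈p∪q⁺ (inj₂ (x∈p∧x∉q⇒x∈p─q x∈p x∉q))

∪-⊆ : p ⊆ r → q ⊆ r → p ∪ q ⊆ r
∪-⊆ {p = p} {q = q} p⊆r q⊆r x∈p∪q with x∈p∪q⁻ p q x∈p∪q
... | inj₁ x∈p = p⊆r x∈p
... | inj₂ x∈q = q⊆r x∈q

Empty⇒∣p∣≡0 : Empty p → ∣ p ∣ ≡ 0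
Empty⇒∣p∣≡0 {n} empty = trans (cong ∣_∣ (Empty-unique empty)) (∣⊥∣≡0 n)

0<∣p∣⇒Nonempty : ∀ (p : Subset n) → 0 < ∣ p ∣ → Nonempty p
0<∣p∣⇒Nonempty p 0<∣p∣ with nonempty? p
... | yes ne   = ne
... | no empty = contradiction (Empty⇒∣p∣≡0 empty) (λ ∣p∣≡0 → <-irrefl (sym ∣p∣≡0) 0<∣p∣)

∣p∪q∣+∣p∩q∣≡∣p∣+∣q∣ : ∀ (p q : Subset n) → ∣ p ∪ q ∣ + ∣ p ∩ q ∣ ≡ ∣ p ∣ + ∣ q ∣
∣p∪q∣+∣p∩q∣≡∣p∣+∣q∣ []            []            = refl
∣p∪q∣+∣p∩q∣≡∣p∣+∣q∣ (outside ∷ p) (outside ∷ q) = ∣p∪q∣+∣p∩q∣≡∣p∣+∣q∣ p q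
∣p∪q∣+∣p∩q∣≡∣p∣+∣q∣ (outside ∷ p) (inside ∷ q)  =
  trans (cong suc (∣p∪q∣+∣p∩q∣≡∣p∣+∣q∣ p q)) (sym (+-suc _ _))
∣p∪q∣+∣p∩q∣≡∣p∣+∣q∣ (inside ∷ p)  (outside ∷ q) = cong suc (∣p∪q∣+∣p∩q∣≡∣p∣+∣q∣ p q)
∣p∪q∣+∣p∩q∣≡∣p∣+∣q∣ (inside ∷ p)  (inside ∷ q)  = cong suc (begin
  ∣ p ∪ q ∣ + suc ∣ p ∩ q ∣ ≡⟨ +-suc _ _ ⟩
  suc (∣ p ∪ q ∣ + ∣ p ∩ q ∣) ≡⟨ cong suc (∣p∪q∣+∣p∩q∣≡∣p∣+∣q∣ p q) ⟩
  suc (∣ p ∣ + ∣ q ∣) ≡⟨ +-suc _ _ ⟨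
  ∣ p ∣ + suc ∣ q ∣ ∎)
  where open ≡-Reasoning

∣p∪q∣≤∣p∣+∣q∣ : ∀ (p q : Subset n) → ∣ p ∪ q ∣ ≤ ∣ p ∣ + ∣ q ∣
∣p∪q∣≤∣p∣+∣q∣ p q = ≤-trans (m≤m+n _ _) (≤-reflexive (∣p∪q∣+∣p∩q∣≡∣p∣+∣q∣ p q))

Empty[p∩q]⇒∣p∪q∣≡∣p∣+∣q∣ : ∀ (p q : Subset n) → Empty (p ∩ q) → ∣ p ∪ q ∣ ≡ ∣ p ∣ + ∣ q ∣
Empty[p∩q]⇒∣p∪q∣≡∣p∣+∣q∣ p q empty = begin
  ∣ p ∪ q ∣                 ≡⟨ +-identityʳ _ ⟨
  ∣ p ∪ q ∣ + 0             ≡⟨ cong (∣ p ∪ q ∣ +_) (Empty⇒∣p∣≡0 empty) ⟨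
  ∣ p ∪ q ∣ + ∣ p ∩ q ∣     ≡⟨ ∣p∪q∣+∣p∩q∣≡∣p∣+∣q∣ p q ⟩
  ∣ p ∣ + ∣ q ∣             ∎
  where open ≡-Reasoning

subset : {P : Pred (Fin n) 0ℓ} → Decidable P → Subset n
subset P? = tabulate (does ∘ P?)

module _ {P : Pred (Fin n) 0ℓ} (P? : Decidable P) where

  ∈-subset⁺ : P x → x ∈ subset P?
  ∈-subset⁺ {x} Px = lookup⇒[]= x (subset P?) (trans (lookup∘tabulate (does ∘ P?) x) (is-yes (P? x)))
    where is-yes : (d : Dec (P x)) → does d ≡ true
          is-yes (yes _)  = refl
          is-yes (no ¬Px) = contradiction Px ¬Px

  ∈-subset⁻ : x ∈ subset P? → P x
  ∈-subset⁻ {x} x∈ = from-does (P? x) (trans (sym (lookup∘tabulate (does ∘ P?) x)) ([]=⇒lookup x∈))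
    where from-does : (d : Dec (P x)) → does d ≡ true → P x
          from-does (yes Px) _ = Px

module HallTheorem {E : Fin n → Fin n → Set} (E? : Decidable₂ E) where

  private variable
    i i′ j u v : Fin n
    L R S T : Subset n

  N : Subset n → Subset n
  N S = subset (λ j → any? (λ i → i ∈? S ×-dec E? i j))

  ∈N⁺ : i ∈ S → E i j → j ∈ N S
  ∈N⁺ {i} i∈S e = ∈-subset⁺ (λ j → any? (λ i → i ∈? _ ×-dec E? i j)) (i , i∈S , e)

  ∈N⁻ : j ∈ N S → ∃ λ i → i ∈ S × E i j
  ∈N⁻ = ∈-subset⁻ (λ j → any? (λ i → i ∈? _ ×-dec E? i j))

  N-mono : S ⊆ T → N S ⊆ N T
  N-mono S⊆T j∈NS with i , i∈S , e ← ∈N⁻ j∈NS = ∈N⁺ (S⊆T i∈S) e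

  HallCondition : Subset n → Subset n → Set
  HallCondition L R = ∀ S → S ⊆ L → ∣ S ∣ ≤ ∣ N S ∩ R ∣

  record Matching (L R : Subset n) : Set where
    field
      match           : Fin n → Fin n
      match-∈         : i ∈ L → match i ∈ R
      match-edge      : i ∈ L → E i (match i)
      match-injective : i ∈ L → i′ ∈ L → match i ≡ match i′ → i ≡ i′
  open Matching

  Matching-mono : T ⊆ L → R ⊆ S → Matching L R → Matching T S
  Matching-mono T⊆L R⊆S M = record
    { match           = match M
    ; match-∈         = R⊆S ∘ match-∈ M ∘ T⊆L
    ; match-edge      = match-edge M ∘ T⊆L
    ; match-injective = λ i∈T i′∈T → match-injective M (T⊆L i∈T) (T⊆L i′∈T)
    }

  empty-matching : Empty L → Matching L R
  empty-matching empty = record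
    { match           = λ i → i
    ; match-∈         = λ i∈L → contradiction (_ , i∈L) empty
    ; match-edge      = λ i∈L → contradiction (_ , i∈L) empty
    ; match-injective = λ i∈L _ _ → contradiction (_ , i∈L) empty
    }

  singleton-matching : E u v → Matching ⁅ u ⁆ ⁅ v ⁆
  singleton-matching {u} {v} e = record
    { match           = λ _ → v
    ; match-∈         = λ _ → x∈⁅x⁆ v
    ; match-edge      = λ i∈⁅u⁆ → subst (λ i → E i v) (sym (x∈⁅y⁆⇒x≡y u i∈⁅u⁆)) e
    ; match-injective = λ i∈⁅u⁆ i′∈⁅u⁆ _ →
                          trans (x∈⁅y⁆⇒x≡y u i∈⁅u⁆) (sym (x∈⁅y⁆⇒x≡y u i′∈⁅u⁆))
    }

  join : ∀ {L₁ L₂ R₁ R₂} → Matching L₁ R₁ → Matching L₂ R₂ → (∀ {j} → j ∈ R₁ → j ∉ R₂) →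
         Matching (L₁ ∪ L₂) (R₁ ∪ R₂)
  join {L₁} {L₂} {R₁} {R₂} M₁ M₂ disjoint = record
    { match = f ; match-∈ = f-∈ ; match-edge = f-edge ; match-injective = f-injective }
    where
    pick : ∀ i → Dec (i ∈ L₁) → Fin n
    pick i (yes _) = match M₁ i
    pick i (no _)  = match M₂ i

    f : Fin n → Fin n
    f i = pick i (i ∈? L₁)

    ∈L₂ : i ∈ L₁ ∪ L₂ → i ∉ L₁ → i ∈ L₂
    ∈L₂ i∈L i∉L₁ with x∈p∪q⁻ L₁ L₂ i∈L
    ... | inj₁ i∈L₁ = contradiction i∈L₁ i∉L₁
    ... | inj₂ i∈L₂ = i∈L₂

    f-∈ : i ∈ L₁ ∪ L₂ → f i ∈ R₁ ∪ R₂
    f-∈ {i} i∈L with i ∈? L₁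
    ... | yes i∈L₁ = x∈p∪q⁺ (inj₁ (match-∈ M₁ i∈L₁))
    ... | no  i∉L₁ = x∈p∪q⁺ (inj₂ (match-∈ M₂ (∈L₂ i∈L i∉L₁)))

    f-edge : i ∈ L₁ ∪ L₂ → E i (f i)
    f-edge {i} i∈L with i ∈? L₁
    ... | yes i∈L₁ = match-edge M₁ i∈L₁
    ... | no  i∉L₁ = match-edge M₂ (∈L₂ i∈L i∉L₁)

    f-injective : i ∈ L₁ ∪ L₂ → i′ ∈ L₁ ∪ L₂ → f i ≡ f i′ → i ≡ i′
    f-injective {i} {i′} i∈L i′∈L fi≡fi′ with i ∈? L₁ | i′ ∈? L₁
    ... | yes i∈L₁ | yes i′∈L₁ = match-injective M₁ i∈L₁ i′∈L₁ fi≡fi′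
    ... | no  i∉L₁ | no  i′∉L₁ = match-injective M₂ (∈L₂ i∈L i∉L₁) (∈L₂ i′∈L i′∉L₁) fi≡fi′
    ... | yes i∈L₁ | no  i′∉L₁ =
      contradiction (match-∈ M₂ (∈L₂ i′∈L i′∉L₁)) (disjoint (subst (_∈ R₁) fi≡fi′ (match-∈ M₁ i∈L₁)))
    ... | no  i∉L₁ | yes i′∈L₁ =
      contradiction (match-∈ M₂ (∈L₂ i∈L i∉L₁)) (disjoint (subst (_∈ R₁) (sym fi≡fi′) (match-∈ M₁ i′∈L₁)))

  hall-neighbour : HallCondition L R → u ∈ L → ∃ λ v → v ∈ R × E u v
  hall-neighbour {L} {R} {u} hall u∈L
    with v , v∈ ← 0<∣p∣⇒Nonempty (N ⁅ u ⁆ ∩ R)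
                   (≤-trans (≤-reflexive (sym (∣⁅x⁆∣≡1 u))) (hall ⁅ u ⁆ (x∈p⇒⁅x⁆⊆p u∈L)))
    with v∈N⁅u⁆ , v∈R ← x∈p∩q⁻ (N ⁅ u ⁆) R v∈
    with i , i∈⁅u⁆ , e ← ∈N⁻ v∈N⁅u⁆
    rewrite x∈⁅y⁆⇒x≡y u i∈⁅u⁆ = v , v∈R , e

  hall-inside : HallCondition L R → T ⊆ L → HallCondition T (N T ∩ R)
  hall-inside {L} {R} {T} hall T⊆L S S⊆T = ≤-trans (hall S (T⊆L ∘ S⊆T)) (p⊆q⇒∣p∣≤∣q∣ shrink)
    where
    shrink : N S ∩ R ⊆ N S ∩ (N T ∩ R)
    shrink j∈ with j∈NS , j∈R ← x∈p∩q⁻ (N S) R j∈ =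
      x∈p∩q⁺ (j∈NS , x∈p∩q⁺ (N-mono S⊆T j∈NS , j∈R))

  hall-outside : HallCondition L R → T ⊆ L → ∣ N T ∩ R ∣ ≤ ∣ T ∣ → HallCondition (L ─ T) (R ─ N T)
  hall-outside {L} {R} {T} hall T⊆L tight S S⊆L─T =
    +-cancelʳ-≤ (∣ T ∣) (∣ S ∣) (∣ N S ∩ (R ─ N T) ∣) (begin
    ∣ S ∣ + ∣ T ∣                               ≡⟨ Empty[p∩q]⇒∣p∪q∣≡∣p∣+∣q∣ S T disjoint ⟨
    ∣ S ∪ T ∣                                   ≤⟨ hall (S ∪ T) (∪-⊆ (p─q⊆p L T ∘ S⊆L─T) T⊆L) ⟩
    ∣ N (S ∪ T) ∩ R ∣                           ≤⟨ p⊆q⇒∣p∣≤∣q∣ split ⟩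
    ∣ N S ∩ (R ─ N T) ∪ N T ∩ R ∣               ≤⟨ ∣p∪q∣≤∣p∣+∣q∣ (N S ∩ (R ─ N T)) (N T ∩ R) ⟩
    ∣ N S ∩ (R ─ N T) ∣ + ∣ N T ∩ R ∣           ≤⟨ +-monoʳ-≤ (∣ N S ∩ (R ─ N T) ∣) tight ⟩
    ∣ N S ∩ (R ─ N T) ∣ + ∣ T ∣                 ∎)
    where
    open ≤-Reasoning
    disjoint : Empty (S ∩ T)
    disjoint (i , i∈S∩T) with i∈S , i∈T ← x∈p∩q⁻ S T i∈S∩T = x∈p─q⇒x∉q (S⊆L─T i∈S) i∈T
    split : N (S ∪ T) ∩ R ⊆ N S ∩ (R ─ N T) ∪ N T ∩ R
    split {j} j∈ with j∈N , j∈R ← x∈p∩q⁻ (N (S ∪ T)) R j∈ | j ∈? N T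
    ... | yes j∈NT = x∈p∪q⁺ (inj₂ (x∈p∩q⁺ (j∈NT , j∈R)))
    ... | no  j∉NT with i , i∈S∪T , e ← ∈N⁻ j∈N | x∈p∪q⁻ S T i∈S∪T
    ...   | inj₁ i∈S = x∈p∪q⁺ (inj₁ (x∈p∩q⁺ (∈N⁺ i∈S e , x∈p∧x∉q⇒x∈p─q j∈R j∉NT)))
    ...   | inj₂ i∈T = contradiction (∈N⁺ i∈T e) j∉NT

  Tight : Subset n → Subset n → Subset n → Set
  Tight L R S = S ⊆ L × Nonempty S × ∣ S ∣ < ∣ L ∣ × ∣ N S ∩ R ∣ ≤ ∣ S ∣

  tight? : ∀ L R → Dec (∃ (Tight L R))
  tight? L R = anySubset? λ S →
    (S ⊆? L) ×-dec nonempty? S ×-dec (∣ S ∣ <? ∣ L ∣) ×-dec (∣ N S ∩ R ∣ ≤? ∣ S ∣)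

  hall-remove : ¬ ∃ (Tight L R) → u ∈ L → HallCondition (L - u) (R - v)
  hall-remove {L} {R} {u} {v} no-tight u∈L S S⊆L-u with nonempty? S
  ... | no  empty = ≤-trans (≤-reflexive (Empty⇒∣p∣≡0 empty)) z≤n
  ... | yes ne    = s≤s⁻¹ (begin
    suc ∣ S ∣                         ≤⟨ ≰⇒> (λ ∣NS∩R∣≤∣S∣ → no-tight (S , S⊆L , ne , ∣S∣<∣L∣ , ∣NS∩R∣≤∣S∣))
                                       ⟩
    ∣ N S ∩ R ∣                       ≤⟨ p⊆q⇒∣p∣≤∣q∣ split ⟩
    ∣ N S ∩ (R - v) ∪ ⁅ v ⁆ ∣         ≤⟨ ∣p∪q∣≤∣p∣+∣q∣ (N S ∩ (R - v)) ⁅ v ⁆ ⟩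
    ∣ N S ∩ (R - v) ∣ + ∣ ⁅ v ⁆ ∣     ≡⟨ cong (∣ N S ∩ (R - v) ∣ +_) (∣⁅x⁆∣≡1 v) ⟩
    ∣ N S ∩ (R - v) ∣ + 1             ≡⟨ +-comm _ 1 ⟩
    suc ∣ N S ∩ (R - v) ∣             ∎)
    where
    open ≤-Reasoning
    S⊆L : S ⊆ L
    S⊆L = p─q⊆p L ⁅ u ⁆ ∘ S⊆L-u
    ∣S∣<∣L∣ : ∣ S ∣ < ∣ L ∣
    ∣S∣<∣L∣ = ≤-<-trans (p⊆q⇒∣p∣≤∣q∣ S⊆L-u) (x∈p⇒∣p-x∣<∣p∣ u∈L)
    split : N S ∩ R ⊆ N S ∩ (R - v) ∪ ⁅ v ⁆
    split {j} j∈ with j∈NS , j∈R ← x∈p∩q⁻ (N S) R j∈ | j ≟ v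
    ... | yes refl = x∈p∪q⁺ (inj₂ (x∈⁅x⁆ v))
    ... | no  j≢v  = x∈p∪q⁺ (inj₁ (x∈p∩q⁺ (j∈NS , x∈p∧x≢y⇒x∈p-y j∈R j≢v)))

  -- Halmos–Vaughan induction: split L along a tight set if there is one, otherwise match
  -- any u ∈ L to any neighbour v; k bounds ∣ L ∣.
  hall-bounded : ∀ k → ∣ L ∣ ≤ k → HallCondition L R → Matching L R
  hall-bounded {L} k ∣L∣≤k hall with nonempty? L
  ... | no empty = empty-matching empty
  hall-bounded zero    ∣L∣≤0 hall | yes (u , u∈L) =
    contradiction (≤-trans (x∈p⇒∣p-x∣<∣p∣ u∈L) ∣L∣≤0) λ ()
  hall-bounded {L} {R} (suc k) ∣L∣≤k hall | yes (u , u∈L) with tight? L R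
  ... | yes (T , T⊆L , (x , x∈T) , ∣T∣<∣L∣ , tight) =
    Matching-mono (p⊆q∪[p─q] T) (∪-⊆ (p∩q⊆q (N T) R) (p─q⊆p R (N T)))
      (join (hall-bounded k (shrinks ∣T∣<∣L∣) (hall-inside hall T⊆L))
            (hall-bounded k (shrinks (p∩q≢∅⇒∣p─q∣<∣p∣ L T (x , x∈p∩q⁺ (T⊆L x∈T , x∈T))))
                          (hall-outside hall T⊆L tight))
            (λ j∈NT∩R j∈R─NT → x∈p─q⇒x∉q j∈R─NT (proj₁ (x∈p∩q⁻ (N T) R j∈NT∩R))))
    where shrinks : ∀ {a} → a < ∣ L ∣ → a ≤ k
          shrinks a<∣L∣ = s≤s⁻¹ (≤-trans a<∣L∣ ∣L∣≤k)
  ... | no no-tight with v , v∈R , e ← hall-neighbour hall u∈L =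
    Matching-mono (p⊆q∪[p─q] ⁅ u ⁆) (∪-⊆ (x∈p⇒⁅x⁆⊆p v∈R) (p─q⊆p R ⁅ v ⁆))
      (join (singleton-matching e)
            (hall-bounded k (s≤s⁻¹ (≤-trans (x∈p⇒∣p-x∣<∣p∣ u∈L) ∣L∣≤k)) (hall-remove no-tight u∈L))
            (λ j∈⁅v⁆ j∈R-v → x∈p─q⇒x∉q j∈R-v j∈⁅v⁆))

  hall-theorem : HallCondition L R → Matching L R
  hall-theorem {L} = hall-bounded ∣ L ∣ ≤-refl

-- König's theorem for regular bipartite graphs

record Regular {E : Fin n → Fin n → Set} (E? : Decidable₂ E) (d : ℕ) : Set where
  field
    row-degree : ∀ i → count (E? i) ≡ d
    col-degree : ∀ j → count (λ i → E? i j) ≡ d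
open Regular

module _ {E : Fin n → Fin n → Set} (E? : Decidable₂ E) where
  open HallTheorem E?

  regular⇒hall : ∀ {d} → Regular E? (suc d) → HallCondition ⊤ ⊤
  regular⇒hall {d} reg S _ = ≤-trans (*-cancelʳ-≤ ∣ S ∣ ∣ N S ∣ (suc d) double-count)
                                     (p⊆q⇒∣p∣≤∣q∣ {p = N S} (λ j∈NS → x∈p∩q⁺ (j∈NS , ∈⊤)))
    where
    open ≤-Reasoning
    double-count : ∣ S ∣ * suc d ≤ ∣ N S ∣ * suc d
    double-count = begin
      ∣ S ∣ * suc d
        ≡⟨ cong (_* suc d) (∣p∣≡count-∈ S) ⟩
      count (_∈? S) * suc d
        ≡⟨ *-distribʳ-sum (suc d) (𝟙 ∘ (_∈? S)) ⟩
      sum (λ i → 𝟙 (i ∈? S) * suc d)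
        ≡⟨ sum-cong-≗ (λ i → cong (𝟙 (i ∈? S) *_) (row-degree reg i)) ⟨
      sum (λ i → 𝟙 (i ∈? S) * count (E? i))
        ≡⟨ sum-cong-≗ (λ i → count-×-dec (i ∈? S) (E? i)) ⟨
      sum (λ i → count (λ j → i ∈? S ×-dec E? i j))
        ≤⟨ sum-mono-≤ (λ i → count-mono _ (λ j → j ∈? N S ×-dec E? i j) (λ (i∈S , e) → ∈N⁺ i∈S e , e)) ⟩
      sum (λ i → count (λ j → j ∈? N S ×-dec E? i j))
        ≡⟨ ∑-comm (λ i j → 𝟙 (j ∈? N S ×-dec E? i j)) ⟩
      sum (λ j → count (λ i → j ∈? N S ×-dec E? i j))
        ≡⟨ sum-cong-≗ (λ j → count-×-dec (j ∈? N S) (λ i → E? i j)) ⟩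
      sum (λ j → 𝟙 (j ∈? N S) * count (λ i → E? i j))
        ≡⟨ sum-cong-≗ (λ j → cong (𝟙 (j ∈? N S) *_) (col-degree reg j)) ⟩
      sum (λ j → 𝟙 (j ∈? N S) * suc d)
        ≡⟨ *-distribʳ-sum (suc d) (𝟙 ∘ (_∈? N S)) ⟨
      count (_∈? N S) * suc d
        ≡⟨ cong (_* suc d) (∣p∣≡count-∈ (N S)) ⟨
      ∣ N S ∣ * suc d ∎

  regular⇒perfect-matching : ∀ {d} → Regular E? (suc d) →
    ∃ λ (f : Fin n → Fin n) → Injective _≡_ _≡_ f × (∀ i → E i (f i))
  regular⇒perfect-matching reg =
    match M , match-injective M ∈⊤ ∈⊤ , λ i → match-edge M ∈⊤
    where M = hall-theorem (regular⇒hall reg)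
          open Matching

  remove-perfect-matching : ∀ {d} {f : Fin n → Fin n} → Regular E? (suc d) →
    Injective _≡_ _≡_ f → (∀ i → E i (f i)) → Regular (λ i j → E? i j ×-dec ¬? (j ≟ f i)) d
  remove-perfect-matching {f = f} reg f-inj f-edge = record
    { row-degree = λ i → suc-injective (trans (sym (count-remove (E? i) (f-edge i))) (row-degree reg i))
    ; col-degree = λ j → suc-injective (trans (sym (col-step j)) (col-degree reg j))
    }
    where
    col-step : ∀ j → count (λ i → E? i j) ≡ suc (count (λ i → E? i j ×-dec ¬? (j ≟ f i)))
    col-step j with i₀ , fi₀≡j ← injective⇒surjective f-inj j = trans
      (count-remove (λ i → E? i j) (subst (E i₀) fi₀≡j (f-edge i₀)))
      (cong suc (count-cong (λ i → E? i j ×-dec ¬? (i ≟ i₀)) (λ i → E? i j ×-dec ¬? (j ≟ f i))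
        (λ (e , i≢i₀) → e , λ j≡fi → i≢i₀ (f-inj (trans (sym j≡fi) (sym fi₀≡j))))
        (λ (e , j≢fi) → e , λ { refl → j≢fi (sym fi₀≡j) })))

record PermutationDecomposition (E : Fin n → Fin n → Set) (d : ℕ) : Set where
  field
    σ           : Fin d → Fin n → Fin n
    σ-edge      : ∀ r i → E i (σ r i)
    σ-injective : ∀ r → Injective _≡_ _≡_ (σ r)
    σ-covers    : ∀ {i j} → E i j → ∃ λ r → σ r i ≡ j
    σ-disjoint  : ∀ {r r′ i} → σ r i ≡ σ r′ i → r ≡ r′
open PermutationDecomposition

konig : ∀ d {E : Fin n → Fin n → Set} (E? : Decidable₂ E) → Regular E? d → PermutationDecomposition E d
konig zero E? reg = record
  { σ = λ () ; σ-edge = λ () ; σ-injective = λ () ; σ-disjoint = λ {r} → case r of λ ()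
  ; σ-covers = λ {i} e → contradiction (trans (sym (count-remove (E? i) e)) (row-degree reg i)) λ ()
  }
konig {n} (suc d) {E} E? reg with f , f-inj , f-edge ← regular⇒perfect-matching E? reg = record
  { σ = σ₊ ; σ-edge = σ₊-edge ; σ-injective = σ₊-injective
  ; σ-covers = σ₊-covers ; σ-disjoint = σ₊-disjoint
  }
  where
  rest : PermutationDecomposition (λ i j → E i j × j ≢ f i) d
  rest = konig d (λ i j → E? i j ×-dec ¬? (j ≟ f i)) (remove-perfect-matching E? reg f-inj f-edge)

  σ₊ : Fin (suc d) → Fin n → Fin n
  σ₊ zero    = f
  σ₊ (suc r) = σ rest r

  σ₊-edge : ∀ r i → E i (σ₊ r i)
  σ₊-edge zero    = f-edge
  σ₊-edge (suc r) i = proj₁ (σ-edge rest r i)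

  σ₊-injective : ∀ r → Injective _≡_ _≡_ (σ₊ r)
  σ₊-injective zero    = f-inj
  σ₊-injective (suc r) = σ-injective rest r

  σ₊-covers : ∀ {i j} → E i j → ∃ λ r → σ₊ r i ≡ j
  σ₊-covers {i} {j} e with j ≟ f i
  ... | yes j≡fi = zero , sym j≡fi
  ... | no  j≢fi with r , σri≡j ← σ-covers rest (e , j≢fi) = suc r , σri≡j

  σ₊-disjoint : ∀ {r r′ i} → σ₊ r i ≡ σ₊ r′ i → r ≡ r′
  σ₊-disjoint {zero}  {zero}   _ = refl
  σ₊-disjoint {zero}  {suc r′} {i} e = contradiction (sym e) (proj₂ (σ-edge rest r′ i))
  σ₊-disjoint {suc r} {zero}   {i} e = contradiction e (proj₂ (σ-edge rest r i))
  σ₊-disjoint {suc r} {suc r′} e = cong suc (σ-disjoint rest e)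

record OneFactorisation (G : Graph) (I : Set) : Set₁ where
  field
    factor          : I → V G → V G → Set
    factor-perfect  : ∀ k → IsPerfectMatching G (factor k)
    factor-covers   : ∀ {u v} → Adj G u v → ∃ λ k → factor k u v
    factor-disjoint : ∀ {u v k l} → factor k u v → factor l u v → k ≡ l
open OneFactorisation

oneFactorable : ∀ {G I c} → Fin c ↔ I → OneFactorisation G I → OneFactorable G
oneFactorable {G} {c = c} ι F =
  c , factor F ∘ to , factor-perfect F ∘ to , covers , disjoint
  where
  open Inverse ι
  covers : ∀ u v → Adj G u v → ∃ λ k → factor F (to k) u v
  covers u v uv with k , f ← factor-covers F uv =
    from k , subst (λ k → factor F k u v) (sym (strictlyInverseˡ k)) f
  disjoint : ∀ {u v k l} → factor F (to k) u v → factor F (to l) u v → k ≡ l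
  disjoint {k = k} {l} f g = begin
    k             ≡⟨ strictlyInverseʳ k ⟨
    from (to k)   ≡⟨ cong from (factor-disjoint F f g) ⟩
    from (to l)   ≡⟨ strictlyInverseʳ l ⟩
    l             ∎
    where open ≡-Reasoning

Complete : ℕ → Graph
Complete m = record { V = Fin m ; Adj = _≢_ }

record FibreBijection {A : Set} {m : ℕ} (f : A → Fin m) (P : A → A → Set) : Set where
  field
    P-sym      : ∀ {u v} → P u v → P v u
    hit        : ∀ u a → f u ≢ a → ∃ λ v → f v ≡ a × P u v
    hit-unique : ∀ {u v w} → f v ≡ f w → P u v → P u w → v ≡ w
open FibreBijection

lift-perfect : ∀ {G : Graph} {m} {f : V G → Fin m} {P M} → FibreBijection f P →
               (∀ {u v} → f u ≢ f v → P u v → Adj G u v) →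
               IsPerfectMatching (Complete m) M →
               IsPerfectMatching G (λ u v → M (f u) (f v) × P u v)
lift-perfect {f = f} {M = M} B adj M-perfect = record
  { edges  = λ (Mfufv , Puv) → adj (edges Mfufv) Puv
  ; symm   = λ (Mfufv , Puv) → symm Mfufv , P-sym B Puv
  ; covers = λ u → let a , Mfua = covers (f u)
                       v , fv≡a , Puv = hit B u a (edges Mfua)
                   in v , subst (M (f u)) (sym fv≡a) Mfua , Puv
  ; unique = λ (Mfufv , Puv) (Mfufw , Puw) → hit-unique B (unique Mfufv Mfufw) Puv Puw
  }
  where open IsPerfectMatching M-perfect

-- The round-robin 1-factorisation of K_(q+1), q odd

half : ∀ s → ∃ λ a → s ≡ a + a ⊎ s ≡ suc (a + a)
half zero = 0 , inj₁ refl
half (suc s) with half s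
... | a , inj₁ s≡2a  = a , inj₂ (cong suc s≡2a)
... | a , inj₂ s≡2a+1 = suc a , inj₁ (cong suc (trans s≡2a+1 (sym (+-suc a a))))

double-injective : ∀ a b → a + a ≡ b + b → a ≡ b
double-injective a b 2a≡2b = trans (n≡⌊n+n/2⌋ a) (trans (cong ⌊_/2⌋ 2a≡2b) (sym (n≡⌊n+n/2⌋ b)))

double≢odd : ∀ a b → a + a ≢ suc (b + b)
double≢odd a b 2a≡2b+1 = even≢odd a b (trans (cong (a +_) (+-identityʳ a))
                                           (trans 2a≡2b+1 (cong suc (sym (cong (b +_) (+-identityʳ b))))))

-- X + Y ≡ S (mod q), for X, Y, S < q.
data SumMod (q S X Y : ℕ) : Set where
  exact : X + Y ≡ S     → SumMod q S X Y
  wrap  : X + Y ≡ S + q → SumMod q S X Y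

module _ {q : ℕ} where

  SumMod-sym : ∀ {S X Y} → SumMod q S X Y → SumMod q S Y X
  SumMod-sym {X = X} {Y} (exact e) = exact (trans (+-comm Y X) e)
  SumMod-sym {X = X} {Y} (wrap e)  = wrap (trans (+-comm Y X) e)

  private
    exact-wrap-right : ∀ {S X Y Y′} → X + Y ≡ S → X + Y′ ≡ S + q → q ≤ Y′
    exact-wrap-right {S} {X} {Y} {Y′} e e′ = ≤-trans (m≤n+m q Y) (≤-reflexive (+-cancelˡ-≡ X _ _ (begin
      X + (Y + q) ≡⟨ +-assoc X Y q ⟨
      X + Y + q   ≡⟨ cong (_+ q) e ⟩
      S + q       ≡⟨ e′ ⟨
      X + Y′      ∎)))
      where open ≡-Reasoning

  SumMod-functional : ∀ {S X Y Y′} → SumMod q S X Y → SumMod q S X Y′ → Y < q → Y′ < q → Y ≡ Y′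
  SumMod-functional {X = X} (exact e) (exact e′) _ _ = +-cancelˡ-≡ X _ _ (trans e (sym e′))
  SumMod-functional {X = X} (wrap e)  (wrap e′)  _ _ = +-cancelˡ-≡ X _ _ (trans e (sym e′))
  SumMod-functional (exact e) (wrap e′) _ Y′<q = contradiction (exact-wrap-right e e′) (<⇒≱ Y′<q)
  SumMod-functional (wrap e) (exact e′) Y<q _ = contradiction (exact-wrap-right e′ e) (<⇒≱ Y<q)

  SumMod-injective : ∀ {S S′ X Y} → SumMod q S X Y → SumMod q S′ X Y → S < q → S′ < q → S ≡ S′
  SumMod-injective (exact e) (exact e′) _ _ = trans (sym e) e′
  SumMod-injective {S} {S′} (wrap e) (wrap e′) _ _ = +-cancelʳ-≡ q S S′ (trans (sym e) e′)
  SumMod-injective {S′ = S′} (exact e) (wrap e′) S<q _ =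
    contradiction (≤-trans (m≤n+m q S′) (≤-reflexive (trans (sym e′) e))) (<⇒≱ S<q)
  SumMod-injective {S = S} (wrap e) (exact e′) _ S′<q =
    contradiction (≤-trans (m≤n+m q S) (≤-reflexive (trans (sym e) e′))) (<⇒≱ S′<q)

  SumMod-partner : ∀ {S X} → S < q → X < q → ∃ λ Y → Y < q × SumMod q S X Y
  SumMod-partner {S} {X} S<q X<q with X ≤? S
  ... | yes X≤S = S ∸ X , ≤-<-trans (m∸n≤m S X) S<q , exact (m+[n∸m]≡n X≤S)
  ... | no  X≰S = S + q ∸ X , S+q∸X<q , wrap (m+[n∸m]≡n X≤S+q)
    where
    X≤S+q : X ≤ S + q
    X≤S+q = ≤-trans (<⇒≤ X<q) (m≤n+m q S)
    S+q∸X<q : S + q ∸ X < q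
    S+q∸X<q = +-cancelˡ-< X _ _ (subst (_< X + q) (sym (m+[n∸m]≡n X≤S+q)) (+-monoˡ-< q (≰⇒> X≰S)))

  SumMod-sum : ∀ {X Y} → X < q → Y < q → ∃ λ S → S < q × SumMod q S X Y
  SumMod-sum {X} {Y} X<q Y<q with X + Y <? q
  ... | yes X+Y<q = X + Y , X+Y<q , exact refl
  ... | no  X+Y≮q = X + Y ∸ q , X+Y∸q<q , wrap (sym (m∸n+n≡m q≤X+Y))
    where
    q≤X+Y : q ≤ X + Y
    q≤X+Y = ≮⇒≥ X+Y≮q
    X+Y∸q<q : X + Y ∸ q < q
    X+Y∸q<q = +-cancelʳ-< q _ _ (subst (_< q + q) (sym (m∸n+n≡m q≤X+Y)) (+-mono-< X<q Y<q))

module _ {q k : ℕ} (q-odd : q ≡ suc (k + k)) where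
  open +-*-Solver using (solve; _:+_; _:=_; con)

  exact-double≢wrap-double : ∀ {S A B} → A + A ≡ S → B + B ≢ S + q
  exact-double≢wrap-double {A = A} {B} e e′ =
    double≢odd B (A + k) (trans e′ (trans (cong₂ _+_ (sym e) q-odd) (shift A k)))
    where shift : ∀ A k → A + A + suc (k + k) ≡ suc (A + k + (A + k))
          shift = solve 2 (λ A k → A :+ A :+ (con 1 :+ (k :+ k)) := con 1 :+ (A :+ k :+ (A :+ k))) refl

  SumMod-double-unique : ∀ {S A B} → SumMod q S A A → SumMod q S B B → A ≡ B
  SumMod-double-unique {A = A} {B} (exact e) (exact e′) = double-injective A B (trans e (sym e′))
  SumMod-double-unique {A = A} {B} (wrap e)  (wrap e′)  = double-injective A B (trans e (sym e′))
  SumMod-double-unique {A = A} {B} (exact e) (wrap e′)  = contradiction e′ (exact-double≢wrap-double {A = A} {B} e)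
  SumMod-double-unique {A = A} {B} (wrap e)  (exact e′) = contradiction e (exact-double≢wrap-double {A = B} {A} e′)

  SumMod-half : ∀ {S} → S < q → ∃ λ F → F < q × SumMod q S F F
  SumMod-half {S} S<q with half S
  ... | a , inj₁ S≡2a   = a , ≤-<-trans (subst (a ≤_) (sym S≡2a) (m≤m+n a a)) S<q , exact (sym S≡2a)
  ... | a , inj₂ S≡2a+1 = a + suc k , a+1+k<q , wrap (trans (shift a k) (cong₂ _+_ (sym S≡2a+1) (sym q-odd)))
    where
    shift : ∀ a k → a + suc k + (a + suc k) ≡ suc (a + a) + suc (k + k)
    shift = solve 2 (λ a k → a :+ (con 1 :+ k) :+ (a :+ (con 1 :+ k)) := con 1 :+ (a :+ a) :+ (con 1 :+ (k :+ k))) refl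
    2a<2k : a + a < k + k
    2a<2k = s≤s⁻¹ (subst₂ _<_ S≡2a+1 q-odd S<q)
    a+1+k<q : a + suc k < q
    a+1+k<q = subst₂ _<_ (sym (+-suc a k)) (sym q-odd)
                (s≤s (+-monoˡ-< k (≰⇒> (λ k≤a → <⇒≱ 2a<2k (+-mono-≤ k≤a k≤a)))))

  -- The value q is the vertex ∞: in factor S it is matched with the X < q satisfying 2X ≡ S.
  data Paired (S : ℕ) : ℕ → ℕ → Set where
    finite : ∀ {X Y} → X < q → Y < q → X ≢ Y → SumMod q S X Y → Paired S X Y
    to-∞   : ∀ {X} → X < q → SumMod q S X X → Paired S X q
    from-∞ : ∀ {Y} → Y < q → SumMod q S Y Y → Paired S q Y

  Paired-sym : ∀ {S X Y} → Paired S X Y → Paired S Y X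
  Paired-sym (finite X<q Y<q X≢Y s) = finite Y<q X<q (X≢Y ∘ sym) (SumMod-sym s)
  Paired-sym (to-∞ X<q s)           = from-∞ X<q s
  Paired-sym (from-∞ Y<q s)         = to-∞ Y<q s

  Paired-irreflexive : ∀ {S X} → ¬ Paired S X X
  Paired-irreflexive (finite _ _ X≢X _) = X≢X refl
  Paired-irreflexive (to-∞ q<q _)       = <-irrefl refl q<q
  Paired-irreflexive (from-∞ q<q _)     = <-irrefl refl q<q

  Paired-functional : ∀ {S X Y Y′} → Paired S X Y → Paired S X Y′ → Y ≡ Y′
  Paired-functional (finite _ Y<q _ s) (finite _ Y′<q _ s′) = SumMod-functional s s′ Y<q Y′<q
  Paired-functional (finite X<q Y<q X≢Y s) (to-∞ _ s′) =
    contradiction (SumMod-functional s′ s X<q Y<q) X≢Y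
  Paired-functional (to-∞ X<q s) (finite _ Y′<q X≢Y′ s′) =
    contradiction (SumMod-functional s s′ X<q Y′<q) X≢Y′
  Paired-functional (to-∞ _ _) (to-∞ _ _) = refl
  Paired-functional (from-∞ _ s) (from-∞ _ s′) = SumMod-double-unique s s′
  Paired-functional (finite q<q _ _ _) (from-∞ _ _) = contradiction q<q (<-irrefl refl)
  Paired-functional (from-∞ _ _) (finite q<q _ _ _) = contradiction q<q (<-irrefl refl)
  Paired-functional (to-∞ q<q _) (from-∞ _ _) = contradiction q<q (<-irrefl refl)
  Paired-functional (from-∞ _ _) (to-∞ q<q _) = contradiction q<q (<-irrefl refl)

  Paired-disjoint : ∀ {S S′ X Y} → Paired S X Y → Paired S′ X Y → S < q → S′ < q → S ≡ S′
  Paired-disjoint (finite _ _ _ s) (finite _ _ _ s′) = SumMod-injective s s′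
  Paired-disjoint (to-∞ _ s)       (to-∞ _ s′)       = SumMod-injective s s′
  Paired-disjoint (from-∞ _ s)     (from-∞ _ s′)     = SumMod-injective s s′
  Paired-disjoint (finite _ q<q _ _) (to-∞ _ _)      = contradiction q<q (<-irrefl refl)
  Paired-disjoint (finite q<q _ _ _) (from-∞ _ _)    = contradiction q<q (<-irrefl refl)
  Paired-disjoint (to-∞ _ _) (finite _ q<q _ _)      = contradiction q<q (<-irrefl refl)
  Paired-disjoint (to-∞ q<q _) (from-∞ _ _)          = contradiction q<q (<-irrefl refl)
  Paired-disjoint (from-∞ _ _) (finite q<q _ _ _)    = contradiction q<q (<-irrefl refl)
  Paired-disjoint (from-∞ _ _) (to-∞ q<q _)          = contradiction q<q (<-irrefl refl)

  private
    ≤q∧≮q⇒≡q : ∀ {X} → X < suc q → ¬ X < q → X ≡ q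
    ≤q∧≮q⇒≡q X<1+q X≮q = ≤-antisym (s≤s⁻¹ X<1+q) (≮⇒≥ X≮q)

  Paired-total : ∀ {S X} → S < q → X < suc q → ∃ λ Y → Y < suc q × Paired S X Y
  Paired-total {S} {X} S<q X<1+q with X <? q
  ... | no X≮q with F , F<q , s ← SumMod-half S<q =
    F , m<n⇒m<1+n F<q , subst (λ X → Paired S X F) (sym (≤q∧≮q⇒≡q X<1+q X≮q)) (from-∞ F<q s)
  ... | yes X<q with Y , Y<q , s ← SumMod-partner S<q X<q | Y ℕ.≟ X
  ...   | yes refl = q , n<1+n q , to-∞ X<q s
  ...   | no  Y≢X  = Y , m<n⇒m<1+n Y<q , finite X<q Y<q (Y≢X ∘ sym) s

  Paired-covers : ∀ {X Y} → X < suc q → Y < suc q → X ≢ Y → ∃ λ S → S < q × Paired S X Y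
  Paired-covers {X} {Y} X<1+q Y<1+q X≢Y with X <? q | Y <? q
  ... | yes X<q | yes Y<q with S , S<q , s ← SumMod-sum X<q Y<q = S , S<q , finite X<q Y<q X≢Y s
  ... | yes X<q | no Y≮q with S , S<q , s ← SumMod-sum X<q X<q =
    S , S<q , subst (Paired S X) (sym (≤q∧≮q⇒≡q Y<1+q Y≮q)) (to-∞ X<q s)
  ... | no X≮q | yes Y<q with S , S<q , s ← SumMod-sum Y<q Y<q =
    S , S<q , subst (λ X → Paired S X Y) (sym (≤q∧≮q⇒≡q X<1+q X≮q)) (from-∞ Y<q s)
  ... | no X≮q | no Y≮q =
    contradiction (trans (≤q∧≮q⇒≡q X<1+q X≮q) (sym (≤q∧≮q⇒≡q Y<1+q Y≮q))) X≢Y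

  round-robin : OneFactorisation (Complete (suc q)) (Fin q)
  round-robin = record
    { factor          = RR
    ; factor-perfect  = λ s → record
      { edges  = λ {x} {y} p x≡y → Paired-irreflexive (subst (RR s x) (sym x≡y) p)
      ; symm   = Paired-sym
      ; covers = partner s
      ; unique = λ p p′ → toℕ-injective (Paired-functional p p′)
      }
    ; factor-covers   = round
    ; factor-disjoint = λ {k = s} {s′} p p′ → toℕ-injective (Paired-disjoint p p′ (toℕ<n s) (toℕ<n s′))
    }
    where
    RR : Fin q → Fin (suc q) → Fin (suc q) → Set
    RR s x y = Paired (toℕ s) (toℕ x) (toℕ y)

    partner : ∀ s x → ∃ λ y → RR s x y
    partner s x with Y , Y<1+q , p ← Paired-total (toℕ<n s) (toℕ<n x) =
      fromℕ< Y<1+q , subst (Paired (toℕ s) (toℕ x)) (sym (toℕ-fromℕ< Y<1+q)) p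

    round : ∀ {x y} → x ≢ y → ∃ λ s → RR s x y
    round {x} {y} x≢y with S , S<q , p ← Paired-covers (toℕ<n x) (toℕ<n y) (x≢y ∘ toℕ-injective) =
      fromℕ< S<q , subst (λ S → Paired S (toℕ x) (toℕ y)) (sym (toℕ-fromℕ< S<q)) p

-- Latin square graphs

symbol-in-row : ∀ {m} (A : LatinSquare m) i s → ∃ λ j → entry A i j ≡ s
symbol-in-row A i = injective⇒surjective (rowInj A i)

module LatinSquareGraphFactorisation {t m : ℕ} (L : Fin t → LatinSquare m)
                                     (orthogonal : ∀ k l → k ≢ l → Orthogonal (L k) (L l)) where

  G : Graph
  G = LatinSquareGraph (L , orthogonal)

  SameLine : Fin (2 + t) → Cell m → Cell m → Set
  SameLine 0F            (i , j) (i′ , j′) = i ≡ i′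
  SameLine 1F            (i , j) (i′ , j′) = j ≡ j′
  SameLine (suc (suc a)) (i , j) (i′ , j′) = entry (L a) i j ≡ entry (L a) i′ j′

  across : Fin (2 + t) → Cell m → Fin m
  across 0F      = proj₂
  across (suc _) = proj₁

  lines-transversal : ∀ c → FibreBijection (across c) (SameLine c)
  lines-transversal 0F = record
    { P-sym = sym ; hit = λ (i , _) a _ → (i , a) , refl , refl
    ; hit-unique = λ { refl refl refl → refl } }
  lines-transversal 1F = record
    { P-sym = sym ; hit = λ (_ , j) a _ → (a , j) , refl , refl
    ; hit-unique = λ { refl refl refl → refl } }
  lines-transversal (suc (suc a)) = record
    { P-sym = sym
    ; hit = λ (i , j) i′ _ → let j′ , e = symbol-in-row (L a) i′ (entry (L a) i j) in (i′ , j′) , refl , sym e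
    ; hit-unique = λ { {v = i′ , _} refl e e′ → cong (i′ ,_) (rowInj (L a) i′ (trans (sym e) e′)) } }

  line-adjacent : ∀ c {u v} → across c u ≢ across c v → SameLine c u v → Adj G u v
  line-adjacent 0F            j≢j′ i≡i′ = j≢j′ ∘ cong proj₂ , inj₁ i≡i′
  line-adjacent 1F            i≢i′ j≡j′ = i≢i′ ∘ cong proj₁ , inj₂ (inj₁ j≡j′)
  line-adjacent (suc (suc a)) i≢i′ same = i≢i′ ∘ cong proj₁ , inj₂ (inj₂ (a , same))

  adjacent⇒line : ∀ {u v} → Adj G u v → ∃ λ c → across c u ≢ across c v × SameLine c u v
  adjacent⇒line {i , j} {i′ , j′} (u≢v , inj₁ i≡i′) =
    0F , (λ j≡j′ → u≢v (cong₂ _,_ i≡i′ j≡j′)) , i≡i′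
  adjacent⇒line {i , j} {i′ , j′} (u≢v , inj₂ (inj₁ j≡j′)) =
    1F , (λ i≡i′ → u≢v (cong₂ _,_ i≡i′ j≡j′)) , j≡j′
  adjacent⇒line {i , j} {i′ , j′} (u≢v , inj₂ (inj₂ (a , same))) =
    suc (suc a) , (λ { refl → u≢v (cong (i ,_) (rowInj (L a) i same)) }) , same

  line-unique : ∀ c c′ {u v} → across c u ≢ across c v → SameLine c u v → SameLine c′ u v → c ≡ c′
  line-unique 0F 0F _ _ _ = refl
  line-unique 1F 1F _ _ _ = refl
  line-unique 0F 1F j≢j′ _ j≡j′ = contradiction j≡j′ j≢j′
  line-unique 1F 0F i≢i′ _ i≡i′ = contradiction i≡i′ i≢i′
  line-unique (suc (suc _)) 0F i≢i′ _ i≡i′ = contradiction i≡i′ i≢i′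
  line-unique 0F (suc (suc b)) {i , _} j≢j′ refl same = contradiction (rowInj (L b) i same) j≢j′
  line-unique 1F (suc (suc b)) {_ , j} i≢i′ refl same = contradiction (colInj (L b) j same) i≢i′
  line-unique (suc (suc a)) 1F {_ , j} i≢i′ same refl = contradiction (colInj (L a) j same) i≢i′
  line-unique (suc (suc a)) (suc (suc b)) i≢i′ same same′ with a ≟ b
  ... | yes refl = refl
  ... | no  a≢b  = contradiction (proj₁ (orthogonal a b a≢b same same′)) i≢i′

  open OneFactorisation

  lines-factorisation : ∀ {J} → OneFactorisation (Complete m) J → OneFactorisation G (Fin (2 + t) × J)
  lines-factorisation {J} K = record
    { factor          = F
    ; factor-perfect  = λ (c , s) → lift-perfect (lines-transversal c) (line-adjacent c) (factor-perfect K s)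
    ; factor-covers   = F-covers
    ; factor-disjoint = F-disjoint
    }
    where
    F : Fin (2 + t) × J → Cell m → Cell m → Set
    F (c , s) u v = factor K s (across c u) (across c v) × SameLine c u v

    F-covers : ∀ {u v} → Adj G u v → ∃ λ k → F k u v
    F-covers uv = let c , apart , same = adjacent⇒line uv
                      s , f           = factor-covers K apart
                  in (c , s) , f , same

    F-disjoint : ∀ {u v k l} → F k u v → F l u v → k ≡ l
    F-disjoint {k = c , s} {c′ , s′} (f , same) (f′ , same′)
      with refl ← line-unique c c′ (IsPerfectMatching.edges (factor-perfect K s) f) same same′ =
      cong (c ,_) (factor-disjoint K f f′)

  CG : Graph
  CG = complement G

  Clash : Fin m → Fin m → Fin m → Fin m → Set
  Clash a b x y = x ≡ y ⊎ ∃ λ c → entry (L c) a x ≡ entry (L c) b y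

  clash? : ∀ a b x y → Dec (Clash a b x y)
  clash? a b x y = (x ≟ y) ⊎-dec any? (λ c → entry (L c) a x ≟ entry (L c) b y)

  Clash-sym : ∀ {a b x y} → Clash a b x y → Clash b a y x
  Clash-sym (inj₁ x≡y)       = inj₁ (sym x≡y)
  Clash-sym (inj₂ (c , same)) = inj₂ (c , sym same)

  clash-count : ∀ {a b} → a ≢ b → ∀ x → count (clash? a b x) ≡ suc t
  clash-count {a} {b} a≢b x = trans (count-cong (clash? a b x) (λ y → any? (λ z → h z ≟ y)) to from)
                                    (count-image h h-injective)
    where
    h : Fin (suc t) → Fin m
    h zero    = x
    h (suc c) = proj₁ (symbol-in-row (L c) b (entry (L c) a x))

    h-same : ∀ c → entry (L c) b (h (suc c)) ≡ entry (L c) a x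
    h-same c = proj₂ (symbol-in-row (L c) b (entry (L c) a x))

    h-moves : ∀ c → h (suc c) ≢ x
    h-moves c hc≡x = a≢b (sym (colInj (L c) x (subst (λ y → entry (L c) b y ≡ entry (L c) a x) hc≡x (h-same c))))

    h-injective : Injective _≡_ _≡_ h
    h-injective {zero}  {zero}   _     = refl
    h-injective {zero}  {suc c}  x≡hc  = contradiction (sym x≡hc) (h-moves c)
    h-injective {suc c} {zero}   hc≡x  = contradiction hc≡x (h-moves c)
    h-injective {suc c} {suc c′} hc≡hc′ with c ≟ c′
    ... | yes refl = refl
    ... | no  c≢c′ = contradiction (proj₁ (orthogonal c c′ c≢c′ (h-same c)
                                             (trans (cong (entry (L c′) b) hc≡hc′) (h-same c′))))
                                   (a≢b ∘ sym)

    to : ∀ {y} → Clash a b x y → ∃ λ z → h z ≡ y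
    to (inj₁ x≡y)        = zero , x≡y
    to (inj₂ (c , same)) = suc c , rowInj (L c) b (trans (h-same c) same)

    from : ∀ {y} → (∃ λ z → h z ≡ y) → Clash a b x y
    from (zero  , x≡y)  = inj₁ x≡y
    from (suc c , refl) = inj₂ (c , sym (h-same c))

  d : ℕ
  d = m ∸ suc t

  compatible-row-degree : ∀ {a b} → a ≢ b → ∀ x → count (λ y → ¬? (clash? a b x y)) ≡ d
  compatible-row-degree {a} {b} a≢b x = trans (count-¬? (clash? a b x)) (cong (m ∸_) (clash-count a≢b x))

  compatible-regular : ∀ {a b} → a ≢ b → Regular (λ x y → ¬? (clash? a b x y)) d
  compatible-regular {a} {b} a≢b = record
    { row-degree = compatible-row-degree a≢b
    ; col-degree = λ y → trans (count-cong (λ x → ¬? (clash? a b x y)) (λ x → ¬? (clash? b a y x))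
                                           (_∘ Clash-sym) (_∘ Clash-sym))
                               (compatible-row-degree (a≢b ∘ sym) y)
    }

  decomposition : ∀ {a b} → a Fin.< b → PermutationDecomposition (λ x y → ¬ Clash a b x y) d
  decomposition a<b = konig d _ (compatible-regular (Finₚ.<⇒≢ a<b))

  open PermutationDecomposition

  Parallel : Fin d → Cell m → Cell m → Set
  Parallel r (i , j) (i′ , j′) = (Σ (i Fin.< i′) λ i<i′ → σ (decomposition i<i′) r j ≡ j′)
                               ⊎ (Σ (i′ Fin.< i) λ i′<i → σ (decomposition i′<i) r j′ ≡ j)

  parallel-transversal : ∀ r → FibreBijection proj₁ (Parallel r)
  parallel-transversal r = record { P-sym = Parallel-sym ; hit = Parallel-hit ; hit-unique = Parallel-unique }
    where
    Parallel-sym : ∀ {u v} → Parallel r u v → Parallel r v u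
    Parallel-sym (inj₁ p) = inj₂ p
    Parallel-sym (inj₂ p) = inj₁ p

    Parallel-hit : ∀ u a → proj₁ u ≢ a → ∃ λ v → proj₁ v ≡ a × Parallel r u v
    Parallel-hit (i , j) a i≢a with Finₚ.<-cmp i a
    ... | tri< i<a _ _ = (a , σ (decomposition i<a) r j) , refl , inj₁ (i<a , refl)
    ... | tri≈ _ i≡a _ = contradiction i≡a i≢a
    ... | tri> _ _ a<i with j′ , σj′≡j ← injective⇒surjective (σ-injective (decomposition a<i) r) j =
      (a , j′) , refl , inj₂ (a<i , σj′≡j)

    Parallel-unique : ∀ {u v w} → proj₁ v ≡ proj₁ w → Parallel r u v → Parallel r u w → v ≡ w
    Parallel-unique {_ , j} {i′ , _} refl (inj₁ (i<i′ , e)) (inj₁ (i<i′′ , e′))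
      rewrite Finₚ.<-irrelevant i<i′ i<i′′ = cong (i′ ,_) (trans (sym e) e′)
    Parallel-unique {_ , j} {i′ , _} refl (inj₂ (i′<i , e)) (inj₂ (i′<i′ , e′))
      rewrite Finₚ.<-irrelevant i′<i i′<i′ =
      cong (i′ ,_) (σ-injective (decomposition i′<i′) r (trans e (sym e′)))
    Parallel-unique refl (inj₁ (i<i′ , _)) (inj₂ (i′<i , _)) = contradiction i′<i (Finₚ.<-asym i<i′)
    Parallel-unique refl (inj₂ (i′<i , _)) (inj₁ (i<i′ , _)) = contradiction i′<i (Finₚ.<-asym i<i′)

  compatible⇒coadjacent : ∀ {i i′ j j′} → i ≢ i′ → ¬ Clash i i′ j j′ → Adj CG (i , j) (i′ , j′)
  compatible⇒coadjacent i≢i′ ¬clash = i≢i′ ∘ cong proj₁ , λ where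
    (_ , inj₁ i≡i′)  → i≢i′ i≡i′
    (_ , inj₂ clash) → ¬clash clash

  coadjacent⇒compatible : ∀ {i i′ j j′} → Adj CG (i , j) (i′ , j′) → i ≢ i′ × ¬ Clash i i′ j j′
  coadjacent⇒compatible (u≢v , ¬adj) =
    (λ i≡i′ → ¬adj (u≢v , inj₁ i≡i′)) , (λ clash → ¬adj (u≢v , inj₂ clash))

  parallel-coadjacent : ∀ r {u v} → proj₁ u ≢ proj₁ v → Parallel r u v → Adj CG u v
  parallel-coadjacent r {i , j} i≢i′ (inj₁ (i<i′ , refl)) =
    compatible⇒coadjacent i≢i′ (σ-edge (decomposition i<i′) r j)
  parallel-coadjacent r {i , j} {i′ , j′} i≢i′ (inj₂ (i′<i , refl)) =
    compatible⇒coadjacent i≢i′ (σ-edge (decomposition i′<i) r j′ ∘ Clash-sym)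

  coadjacent⇒parallel : ∀ {u v} → Adj CG u v → proj₁ u ≢ proj₁ v × ∃ λ r → Parallel r u v
  coadjacent⇒parallel {i , j} {i′ , j′} uv with i≢i′ , ¬clash ← coadjacent⇒compatible uv | Finₚ.<-cmp i i′
  ... | tri< i<i′ _ _ =
    i≢i′ , let r , e = σ-covers (decomposition i<i′) ¬clash in r , inj₁ (i<i′ , e)
  ... | tri≈ _ i≡i′ _ = contradiction i≡i′ i≢i′
  ... | tri> _ _ i′<i =
    i≢i′ , let r , e = σ-covers (decomposition i′<i) (¬clash ∘ Clash-sym) in r , inj₂ (i′<i , e)

  Parallel-disjoint : ∀ {r r′ u v} → Parallel r u v → Parallel r′ u v → r ≡ r′
  Parallel-disjoint (inj₁ (i<i′ , e)) (inj₁ (i<i′′ , e′))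
    rewrite Finₚ.<-irrelevant i<i′ i<i′′ = σ-disjoint (decomposition i<i′′) (trans e (sym e′))
  Parallel-disjoint (inj₂ (i′<i , e)) (inj₂ (i′<i′ , e′))
    rewrite Finₚ.<-irrelevant i′<i i′<i′ = σ-disjoint (decomposition i′<i′) (trans e (sym e′))
  Parallel-disjoint (inj₁ (i<i′ , _)) (inj₂ (i′<i , _)) = contradiction i′<i (Finₚ.<-asym i<i′)
  Parallel-disjoint (inj₂ (i′<i , _)) (inj₁ (i<i′ , _)) = contradiction i′<i (Finₚ.<-asym i<i′)

  complement-factorisation : ∀ {J} → OneFactorisation (Complete m) J → OneFactorisation CG (J × Fin d)
  complement-factorisation {J} K = record
    { factor          = F
    ; factor-perfect  = λ (s , r) → lift-perfect (parallel-transversal r) (parallel-coadjacent r) (factor-perfect K s)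
    ; factor-covers   = F-covers
    ; factor-disjoint = λ (f , p) (f′ , p′) → cong₂ _,_ (factor-disjoint K f f′) (Parallel-disjoint p p′)
    }
    where
    F : J × Fin d → Cell m → Cell m → Set
    F (s , r) u v = factor K s (proj₁ u) (proj₁ v) × Parallel r u v

    F-covers : ∀ {u v} → Adj CG u v → ∃ λ k → F k u v
    F-covers uv = let i≢i′ , r , p = coadjacent⇒parallel uv
                      s , f        = factor-covers K i≢i′
                  in (s , r) , f , p

corollary2p4 : (t m : ℕ) → m ≥ 2 → Even m → (L : MOLS t m) →
    OneFactorable (LatinSquareGraph L) × OneFactorable (complement (LatinSquareGraph L))
corollary2p4 t .(0 + 0) () (zero , refl) L
corollary2p4 t .(suc k + suc k) _ (suc k , refl) (L , orthogonal) =
  oneFactorable *↔× (lines-factorisation K) , oneFactorable *↔× (complement-factorisation K)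
  where
  open LatinSquareGraphFactorisation L orthogonal
  K : OneFactorisation (Complete (suc k + suc k)) (Fin (k + suc k))
  K = round-robin {k = k} (+-suc k k)
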